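{- For every integer $n \geq 10$, $rsat(n,C_7) \leq 2n-2$.
   Context: All graphs are finite, simple and undirected. An edge-coloring of a graph $G$ is a function $\mathcal{C}:E(G)\to\mathbb{N}$; a (sub)graph is rainbow if all its edges have distinct colors. An edge-colored graph $G$ is $F$-rainbow saturated if it contains no rainbow copy of $F$ but adding any nonedge of $G$ with any color on it creates a rainbow copy of $F$. $rsat(n,F)$ is the minimum number of edges of a graph on $n$ vertices admitting an edge-coloring that makes it $F$-rainbow saturated. $C_r$ is the cycle on $r$ vertices. -}

module Defs where

open import Data.Nat using (ℕ; zero; suc; _+_; _<_; _≤_; _∸_; _*_)
open import Data.Nat.Properties using (_<?_)
open import Data.Bool using (Bool; true; false; _∨_; _∧_; if_then_else_)
open import Data.Fin using (Fin; toℕ; _≟_)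
open import Data.Fin.Patterns
open import Data.List using (List; map; allFin)
open import Data.Nat.ListAction using (sum)
open import Data.Product using (Σ; _×_; _,_)
open import Function.Definitions using (Injective)
open import Relation.Binary.PropositionalEquality using (_≡_)
open import Relation.Nullary using (¬_)
open import Relation.Nullary.Decidable using (⌊_⌋)

record Graph (n : ℕ) : Set where
  field
    adj   : Fin n → Fin n → Bool
    sym   : ∀ i j → adj i j ≡ adj j i
    irrefl : ∀ i → adj i i ≡ false
open Graph public

-- An edge-coloring: a symmetric assignment of a colour (a natural number)
-- to every unordered pair; only the values on edges matter.
record EdgeColoring {n : ℕ} (G : Graph n) : Set where
  field
    col    : Fin n → Fin n → ℕ
    colSym : ∀ i j → col i j ≡ col j i
open EdgeColoring public

edgeCount : ∀ {n} → Graph n → ℕ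
edgeCount {n} G =
  sum (map (λ i → sum (map (λ j →
        if ⌊ toℕ i <? toℕ j ⌋ ∧ adj G i j then 1 else 0) (allFin n))) (allFin n))

next7 : Fin 7 → Fin 7
next7 0F = 1F
next7 1F = 2F
next7 2F = 3F
next7 3F = 4F
next7 4F = 5F
next7 5F = 6F
next7 6F = 0F

RainbowC7 : ∀ {n} → (Fin n → Fin n → Bool) → (Fin n → Fin n → ℕ) → Set
RainbowC7 {n} a c =
  Σ (Fin 7 → Fin n) λ v →
    Injective _≡_ _≡_ v
    × (∀ i → a (v i) (v (next7 i)) ≡ true)
    × Injective _≡_ _≡_ (λ i → c (v i) (v (next7 i)))

samePair : ∀ {n} → Fin n → Fin n → Fin n → Fin n → Bool
samePair u v x y = (⌊ x ≟ u ⌋ ∧ ⌊ y ≟ v ⌋) ∨ (⌊ x ≟ v ⌋ ∧ ⌊ y ≟ u ⌋)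

addEdgeAdj : ∀ {n} → Graph n → Fin n → Fin n → Fin n → Fin n → Bool
addEdgeAdj G u v x y = adj G x y ∨ samePair u v x y

addEdgeCol : ∀ {n} {G : Graph n} → EdgeColoring G → Fin n → Fin n → ℕ
           → Fin n → Fin n → ℕ
addEdgeCol C u v k x y = if samePair u v x y then k else col C x y

RainbowSaturatedC7 : ∀ {n} (G : Graph n) → EdgeColoring G → Set
RainbowSaturatedC7 {n} G C =
  ¬ RainbowC7 (adj G) (col C)
  × (∀ (u v : Fin n) → ¬ (u ≡ v) → adj G u v ≡ false → (k : ℕ) →
       RainbowC7 (addEdgeAdj G u v) (addEdgeCol C u v k))

RsatC7≤ : ℕ → ℕ → Set
RsatC7≤ n m = Σ (Graph n) λ G → edgeCount G ≤ m × Σ (EdgeColoring G) λ C → RainbowSaturatedC7 G C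

-- The graph is a fixed core H on 9 vertices with 16 coloured edges, together with n − 9
-- pendant vertices, each joined to the two hubs 0 and 1 of H by edges of fresh colours; it
-- has 16 + 2(n − 9) = 2n − 2 edges.  A rainbow C₇ through a pendant vertex enters and leaves
-- it through both hubs, so no other pendant vertex lies on it and the rest of it is a rainbow
-- path of six core vertices from hub to hub; H has no such path and no rainbow C₇ of its own.
-- Conversely, a non-edge uv coloured k closes into a rainbow C₇ along any rainbow path of
-- length 6 from u to v that avoids the colour k.  As k is arbitrary, it suffices to find one
-- such path p₀ and, for every colour of p₀, a further path avoiding that colour.  These finite
-- facts about H are decided by an exhaustive search for rainbow paths, proved sound and
-- complete for arbitrary edge-coloured graphs.

module Submission where

open import Defs hiding (sym)
open import Data.Bool using (Bool; true; false; _∧_; _∨_; if_then_else_)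
import Data.Bool as Bool
import Data.Bool.Properties as Boolₚ
open import Data.Bool.ListAction using (any)
open import Data.Empty using (⊥; ⊥-elim)
open import Data.Fin as Fin using (Fin; zero; suc; toℕ; inject₁; _↑ˡ_; _↑ʳ_; splitAt; combine)
open import Data.Fin.Patterns
import Data.Fin.Properties as Finₚ
open import Data.List using (List; []; _∷_; [_]; _++_; _∷ʳ_; map; filter; concatMap; foldr; tabulate; allFin; length)
import Data.List.Properties as Listₚ
open import Data.List.Membership.Propositional using (_∈_; _∉_; find)
open import Data.List.Membership.Propositional.Properties
  using (∈-allFin; ∈-map⁺; ∈-map⁻; ∈-filter⁺; ∈-filter⁻; ∈-concatMap⁺; ∈-concatMap⁻;
         ∈-++⁺ˡ; ∈-++⁺ʳ; ∈-++⁻)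
import Data.List.Membership.DecPropositional as DecMembership
open import Data.List.Relation.Unary.All as All using (All; []; _∷_)
import Data.List.Relation.Unary.All.Properties as Allₚ
open import Data.List.Relation.Unary.Any as Any using (Any; here; there)
open import Data.List.Relation.Unary.Linked using (Linked; []; [-]; _∷_)
open import Data.List.Relation.Unary.AllPairs using ([]; _∷_)
open import Data.List.Relation.Unary.Unique.Propositional using (Unique)
import Data.List.Relation.Unary.Unique.Propositional.Properties as Uniqueₚ
open import Data.Nat as ℕ using (ℕ; zero; suc; _+_; _*_; _∸_; _≤_; _<_)
import Data.Nat.Properties as ℕₚ
open import Data.Nat.ListAction using (sum)
import Data.Nat.ListAction.Properties as Sumₚ
open import Algebra.Properties.CommutativeSemigroup ℕₚ.+-commutativeSemigroup
  using () renaming (interchange to +-interchange)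
open import Data.Product using (Σ; ∃-syntax; _×_; _,_; proj₁; proj₂)
open import Data.Sum using (_⊎_; inj₁; inj₂; [_,_]′)
open import Data.Unit using (⊤; tt)
open import Data.Vec as Vec using (Vec; []; _∷_)
open import Function using (_∘_; id)
open import Function.Definitions using (Injective)
open import Relation.Binary.Definitions using (DecidableEquality)
open import Relation.Binary.PropositionalEquality
  using (_≡_; _≢_; refl; sym; trans; cong; cong₂; subst; ≡-≟-identity; module ≡-Reasoning)
open import Relation.Nullary using (¬_; Dec; yes; no; ¬?)
open import Relation.Nullary.Decidable using (⌊_⌋; from-yes; _×-dec_; _→-dec_)

unique-tabulate⁻ : ∀ {A : Set} {n} {f : Fin n → A} → Unique (tabulate f) → Injective _≡_ _≡_ f
unique-tabulate⁻ {n = suc n} (_ ∷ _)   {zero}  {zero}  _  = refl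
unique-tabulate⁻ {n = suc n} (f₀∉ ∷ _) {zero}  {suc j} eq = ⊥-elim (Allₚ.tabulate⁻ f₀∉ j eq)
unique-tabulate⁻ {n = suc n} (f₀∉ ∷ _) {suc i} {zero}  eq = ⊥-elim (Allₚ.tabulate⁻ f₀∉ i (sym eq))
unique-tabulate⁻ {n = suc n} (_ ∷ u)   {suc i} {suc j} eq = cong suc (unique-tabulate⁻ u eq)

unique-∷ʳ : ∀ {A : Set} {xs : List A} {x} → Unique xs → x ∉ xs → Unique (xs ∷ʳ x)
unique-∷ʳ u x∉xs = Uniqueₚ.++⁺ u ([] ∷ []) λ { (x∈xs , here refl) → x∉xs x∈xs }

Inhabited : ∀ {A : Set} → List A → Set
Inhabited xs = ∃[ x ] x ∈ xs

inhabited? : ∀ {A : Set} (xs : List A) → Dec (Inhabited xs)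
inhabited? []      = no λ ()
inhabited? (x ∷ _) = yes (x , here refl)

sum-map-if : ∀ {A : Set} b (xs : List A) → sum (map (λ _ → if b then 1 else 0) xs) ≡ (if b then length xs else 0)
sum-map-if true  []       = refl
sum-map-if true  (_ ∷ xs) = cong suc (sum-map-if true xs)
sum-map-if false []       = refl
sum-map-if false (_ ∷ xs) = sum-map-if false xs

sum-map-+ : ∀ {A : Set} (f g : A → ℕ) xs → sum (map (λ x → f x + g x) xs) ≡ sum (map f xs) + sum (map g xs)
sum-map-+ f g []       = refl
sum-map-+ f g (x ∷ xs) = begin
  (f x + g x) + sum (map (λ x → f x + g x) xs)  ≡⟨ cong (f x + g x +_) (sum-map-+ f g xs) ⟩
  (f x + g x) + (sum (map f xs) + sum (map g xs)) ≡⟨ +-interchange (f x) (g x) _ _ ⟩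
  (f x + sum (map f xs)) + (g x + sum (map g xs)) ∎
  where open ≡-Reasoning

no-three-into-pair : ∀ {A : Set} {n} {v : Fin n → A} {x y : A} {i j k} → Injective _≡_ _≡_ v →
              i ≢ j → i ≢ k → j ≢ k → v i ∈ x ∷ [ y ] → v j ∈ x ∷ [ y ] → v k ∈ x ∷ [ y ] → ⊥
no-three-into-pair inj i≢j _   _   (here p)         (here q)         _                = i≢j (inj (trans p (sym q)))
no-three-into-pair inj i≢j _   _   (there (here p)) (there (here q)) _                = i≢j (inj (trans p (sym q)))
no-three-into-pair inj _   i≢k _   (here p)         (there (here _)) (here r)         = i≢k (inj (trans p (sym r)))
no-three-into-pair inj _   _   j≢k (here _)         (there (here q)) (there (here r)) = j≢k (inj (trans q (sym r)))
no-three-into-pair inj _   i≢k _   (there (here p)) (here _)         (there (here r)) = i≢k (inj (trans p (sym r)))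
no-three-into-pair inj _   _   j≢k (there (here _)) (here q)         (here r)         = j≢k (inj (trans q (sym r)))

module RainbowPaths {V : Set} (_≟_ : DecidableEquality V) (adj : V → V → Bool) (col : V → V → ℕ) where

  open DecMembership _≟_ using (_∈?_)

  Adjacent : V → V → Set
  Adjacent x y = adj x y ≡ true

  colours : List V → List ℕ
  colours (x ∷ y ∷ p) = col x y ∷ colours (y ∷ p)
  colours _           = []

  record IsRainbowPath (p : List V) : Set where
    field
      distinct : Unique p
      linked   : Linked Adjacent p
      rainbow  : Unique (colours p)
  open IsRainbowPath public

  [-]-rainbow : ∀ {x} → IsRainbowPath [ x ]
  [-]-rainbow = record { distinct = [] ∷ [] ; linked = [-] ; rainbow = [] }

  Extends : V → List V → Set
  Extends y []      = ⊤
  Extends y (x ∷ p) = All (y ≢_) (x ∷ p) × Adjacent y x × All (col y x ≢_) (colours (x ∷ p))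

  extends? : ∀ y p → Dec (Extends y p)
  extends? y []      = yes tt
  extends? y (x ∷ p) = All.all? (λ z → ¬? (y ≟ z)) (x ∷ p)
                 ×-dec adj y x Bool.≟ true
                 ×-dec All.all? (λ κ → ¬? (col y x ℕ.≟ κ)) (colours (x ∷ p))

  ∷-rainbow : ∀ {y p} → Extends y p → IsRainbowPath p → IsRainbowPath (y ∷ p)
  ∷-rainbow {p = []}    _                  _ = [-]-rainbow
  ∷-rainbow {p = _ ∷ _} (y∉p , y~x , κ∉) r = record
    { distinct = y∉p ∷ distinct r ; linked = y~x ∷ linked r ; rainbow = κ∉ ∷ rainbow r }

  ∷-rainbow⁻ : ∀ {y p} → IsRainbowPath (y ∷ p) → Extends y p × IsRainbowPath p
  ∷-rainbow⁻ {p = []}    _ = tt , record { distinct = [] ; linked = [] ; rainbow = [] }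
  ∷-rainbow⁻ {p = _ ∷ _} record { distinct = y∉p ∷ u ; linked = y~x ∷ l ; rainbow = κ∉ ∷ ρ } =
    (y∉p , y~x , κ∉) , record { distinct = u ; linked = l ; rainbow = ρ }

  colours-∷ʳ : ∀ p s x → colours (p ∷ʳ s ∷ʳ x) ≡ colours (p ∷ʳ s) ∷ʳ col s x
  colours-∷ʳ []          s x = refl
  colours-∷ʳ (y ∷ [])    s x = refl
  colours-∷ʳ (y ∷ z ∷ p) s x = cong (col y z ∷_) (colours-∷ʳ (z ∷ p) s x)

  linked-∷ʳ : ∀ p {s x} → Linked Adjacent (p ∷ʳ s) → Adjacent s x → Linked Adjacent (p ∷ʳ s ∷ʳ x)
  linked-∷ʳ []          _         s~x = s~x ∷ [-]
  linked-∷ʳ (y ∷ [])    (y~s ∷ _) s~x = y~s ∷ s~x ∷ [-]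
  linked-∷ʳ (y ∷ z ∷ p) (y~z ∷ l) s~x = y~z ∷ linked-∷ʳ (z ∷ p) l s~x

  ∷ʳ-rainbow : ∀ p {s x} → IsRainbowPath (p ∷ʳ s) → x ∉ p ∷ʳ s → Adjacent s x →
               col s x ∉ colours (p ∷ʳ s) → IsRainbowPath (p ∷ʳ s ∷ʳ x)
  ∷ʳ-rainbow p {s} {x} r x∉ s~x κ∉ = record
    { distinct = unique-∷ʳ (distinct r) x∉
    ; linked   = linked-∷ʳ p (linked r) s~x
    ; rainbow  = subst Unique (sym (colours-∷ʳ p s x)) (unique-∷ʳ (rainbow r) κ∉) }

  StartsIn : List V → List V → Set
  StartsIn X []      = ⊥
  StartsIn X (x ∷ _) = x ∈ X

  startsIn? : ∀ X p → Dec (StartsIn X p)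
  startsIn? X []      = no λ ()
  startsIn? X (x ∷ _) = x ∈? X

  ClosesAt : V → List V → Set
  ClosesAt s []      = ⊥
  ClosesAt s (x ∷ p) = Adjacent s x × All (col s x ≢_) (colours (x ∷ p))

  closesAt? : ∀ s p → Dec (ClosesAt s p)
  closesAt? s []      = no λ ()
  closesAt? s (x ∷ p) = adj s x Bool.≟ true ×-dec All.all? (λ κ → ¬? (col s x ℕ.≟ κ)) (colours (x ∷ p))

  module _ (cands : List V) where

    extensions : List V → List (List V)
    extensions p = map (_∷ p) (filter (λ y → extends? y p) cands)

    pathsFrom : ℕ → List V → List (List V)
    pathsFrom zero    p = [ p ]
    pathsFrom (suc k) p = concatMap extensions (pathsFrom k p)

    pathsBetween : ℕ → V → V → List (List V)
    pathsBetween k s t = filter (startsIn? [ t ]) (pathsFrom k [ s ])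

    pathsFrom-complete : ∀ q {p} → IsRainbowPath (q ++ p) → All (_∈ cands) q →
                         q ++ p ∈ pathsFrom (length q) p
    pathsFrom-complete []      _ _          = here refl
    pathsFrom-complete (y ∷ q) r (y∈ ∷ q∈) =
      let y-extends , r′ = ∷-rainbow⁻ r in
      ∈-concatMap⁺ extensions
        (Any.map (λ { refl → ∈-map⁺ (_∷ _) (∈-filter⁺ (λ z → extends? z _) y∈ y-extends) }) (pathsFrom-complete q r′ q∈))

    ∈-extensions⁻ : ∀ {p q} → q ∈ extensions p → ∃[ y ] y ∈ cands × Extends y p × q ≡ y ∷ p
    ∈-extensions⁻ q∈ with ∈-map⁻ (_∷ _) q∈
    ... | y , y∈ , refl =
      let y∈cands , y-extends = ∈-filter⁻ (λ z → extends? z _) y∈ in y , y∈cands , y-extends , refl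

    ∈-pathsFrom⁻ : ∀ k {p q} → IsRainbowPath p → q ∈ pathsFrom k p →
                   Σ (Vec V k) λ r → q ≡ Vec.toList r ++ p × All (_∈ cands) (Vec.toList r) × IsRainbowPath q
    ∈-pathsFrom⁻ zero    ρ (here refl) = [] , refl , [] , ρ
    ∈-pathsFrom⁻ (suc k) ρ q∈ with find (∈-concatMap⁻ extensions q∈)
    ... | q′ , q′∈ , q∈ext with ∈-pathsFrom⁻ k ρ q′∈ | ∈-extensions⁻ q∈ext
    ... | r , refl , r∈ , ρ′ | y , y∈ , y-extends , refl =
      y ∷ r , refl , y∈ ∷ r∈ , ∷-rainbow y-extends ρ′

    Route : ℕ → V → V → List V → Set
    Route k s t p =
      Σ (Vec V k) λ r → p ≡ t ∷ Vec.toList r ∷ʳ s × All (_∈ cands) (t ∷ Vec.toList r) × IsRainbowPath p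

    ∈-pathsBetween⁻ : ∀ k {s t p} → p ∈ pathsBetween (suc k) s t → Route k s t p
    ∈-pathsBetween⁻ k p∈ with ∈-filter⁻ (startsIn? _) p∈
    ... | p∈′ , starts with ∈-pathsFrom⁻ (suc k) [-]-rainbow p∈′
    ... | t′ ∷ r , refl , r∈ , ρ with starts
    ...   | here refl = r , refl , r∈ , ρ

  Avoids : ℕ → List V → Set
  Avoids k p = All (k ≢_) (colours p)

  avoids? : ∀ k p → Dec (Avoids k p)
  avoids? k p = All.all? (λ κ → ¬? (k ℕ.≟ κ)) (colours p)

  AvoidsEach : List (List V) → Set
  AvoidsEach S = Any (λ p₀ → All (λ κ → Any (Avoids κ) S) (colours p₀)) S

  avoidsEach? : ∀ S → Dec (AvoidsEach S)
  avoidsEach? S = Any.any? (λ p₀ → All.all? (λ κ → Any.any? (avoids? κ) S) (colours p₀)) S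

  avoids-above : ∀ {b k p} → All (_< b) (colours p) → b ≤ k → Avoids k p
  avoids-above small b≤k = All.map (λ κ<b → ℕₚ.>⇒≢ (ℕₚ.<-≤-trans κ<b b≤k)) small

  avoidsEach⇒avoids : ∀ {S} → AvoidsEach S → ∀ k → Any (Avoids k) S
  avoidsEach⇒avoids ok k with find ok
  ... | p₀ , p₀∈S , alternatives with Any.any? (k ℕ.≟_) (colours p₀)
  ...   | yes k∈ = All.lookup alternatives k∈
  ...   | no  k∉ = Any.map (λ { refl → Allₚ.¬Any⇒All¬ _ k∉ }) p₀∈S

  -- Eₕ are the colours of the edges that complete the paths of Sₕ to a cycle.  A colour lying
  -- in some Eₕ is at least b, so every path of the other side avoids it.
  avoid-one-side : ∀ {S₀ S₁ : List (List V)} {E₀ E₁ : List ℕ} {b} →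
    AvoidsEach (S₀ ++ S₁) → Inhabited S₀ → Inhabited S₁ →
    (∀ {p} → p ∈ S₀ ++ S₁ → All (_< b) (colours p)) → All (b ≤_) (E₀ ++ E₁) →
    (∀ {k} → k ∈ E₀ → k ∉ E₁) → ∀ k →
    (∃[ p ] p ∈ S₀ × Avoids k p × k ∉ E₀) ⊎ (∃[ p ] p ∈ S₁ × Avoids k p × k ∉ E₁)
  avoid-one-side {S₀} {S₁} {E₀} {E₁} ok (p₀ , p₀∈) (p₁ , p₁∈) small large disjoint k
    with Any.any? (k ℕ.≟_) E₀ | Any.any? (k ℕ.≟_) E₁
  ... | yes k∈E₀ | _        =
    inj₂ (p₁ , p₁∈ , avoids-above (small (∈-++⁺ʳ S₀ p₁∈)) (All.lookup large (∈-++⁺ˡ k∈E₀)) ,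
          disjoint k∈E₀)
  ... | no k∉E₀  | yes k∈E₁ =
    inj₁ (p₀ , p₀∈ , avoids-above (small (∈-++⁺ˡ p₀∈)) (All.lookup large (∈-++⁺ʳ E₀ k∈E₁)) , k∉E₀)
  ... | no k∉E₀  | no k∉E₁  with find (avoidsEach⇒avoids ok k)
  ...   | p , p∈ , avoids with ∈-++⁻ S₀ p∈
  ...     | inj₁ p∈S₀ = inj₁ (p , p∈S₀ , avoids , k∉E₀)
  ...     | inj₂ p∈S₁ = inj₂ (p , p∈S₁ , avoids , k∉E₁)

next7-injective : Injective _≡_ _≡_ next7
next7-injective {i} {j} = from-yes (Finₚ.all? λ i → Finₚ.all? λ j → next7 i Fin.≟ next7 j →-dec i Fin.≟ j) i j

next7ⁿ : ℕ → Fin 7 → Fin 7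
next7ⁿ zero    = id
next7ⁿ (suc k) = next7 ∘ next7ⁿ k

next7ⁿ-from-0 : ∀ i → next7ⁿ (toℕ i) 0F ≡ i
next7ⁿ-from-0 = from-yes (Finₚ.all? λ i → next7ⁿ (toℕ i) 0F Fin.≟ i)

module RainbowCycles {n} (a : Fin n → Fin n → Bool) (c : Fin n → Fin n → ℕ) where

  open RainbowPaths Fin._≟_ a c

  rotate : RainbowC7 a c → RainbowC7 a c
  rotate (v , v-inj , v-adj , v-rainbow) =
    v ∘ next7 , (λ eq → next7-injective (v-inj eq)) , v-adj ∘ next7 , (λ eq → next7-injective (v-rainbow eq))

  rotations : ℕ → RainbowC7 a c → RainbowC7 a c
  rotations zero    R = R
  rotations (suc k) R = rotations k (rotate R)

  rotations-vertex : ∀ k R j → proj₁ (rotations k R) j ≡ proj₁ R (next7ⁿ k j)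
  rotations-vertex zero    R j = refl
  rotations-vertex (suc k) R j = rotations-vertex k (rotate R) j

  rotate-to : ∀ i R → ∃[ R′ ] proj₁ R′ 0F ≡ proj₁ R i
  rotate-to i R = rotations (toℕ i) R , trans (rotations-vertex (toℕ i) R 0F) (cong (proj₁ R) (next7ⁿ-from-0 i))

  closing-path : (R : RainbowC7 a c) → let v = proj₁ R in
                 IsRainbowPath (tabulate (v ∘ next7)) × ClosesAt (v 0F) (tabulate (v ∘ next7))
  closing-path (v , v-inj , v-adj , v-rainbow) with Uniqueₚ.tabulate⁺ v-rainbow
  ... | first-colour-fresh ∷ ρ =
    record { distinct = Uniqueₚ.tabulate⁺ (λ eq → next7-injective (v-inj eq))
           ; linked   = v-adj 1F ∷ v-adj 2F ∷ v-adj 3F ∷ v-adj 4F ∷ v-adj 5F ∷ v-adj 6F ∷ [-]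
           ; rainbow  = ρ }
    , v-adj 0F , first-colour-fresh

  inner-path : (R : RainbowC7 a c) → IsRainbowPath (tabulate (proj₁ R ∘ suc))
  inner-path (v , v-inj , v-adj , v-rainbow) with Uniqueₚ.tabulate⁺ v-rainbow
  ... | _ ∷ ρ =
    record { distinct = Uniqueₚ.tabulate⁺ (λ eq → Finₚ.suc-injective (v-inj eq))
           ; linked   = v-adj 1F ∷ v-adj 2F ∷ v-adj 3F ∷ v-adj 4F ∷ v-adj 5F ∷ [-]
           ; rainbow  = Uniqueₚ.take⁺ 5 ρ }

module AddingEdges {n} (G : Graph n) (C : EdgeColoring G) where

  open RainbowPaths Fin._≟_ (adj G) (col C)

  samePair-refl : ∀ (u w : Fin n) → samePair u w u w ≡ true
  samePair-refl u w rewrite ≡-≟-identity Fin._≟_ {u} refl | ≡-≟-identity Fin._≟_ {w} refl = refl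

  samePair-sound : ∀ {u w x y : Fin n} → samePair u w x y ≡ true → (x ≡ u × y ≡ w) ⊎ (x ≡ w × y ≡ u)
  samePair-sound {u} {w} {x} {y} eq with x Fin.≟ u | y Fin.≟ w | x Fin.≟ w | y Fin.≟ u
  ... | yes x≡u | yes y≡w | _       | _       = inj₁ (x≡u , y≡w)
  ... | _       | _       | yes x≡w | yes y≡u = inj₂ (x≡w , y≡u)
  ... | yes _   | no _    | yes _   | no _    with () ← eq
  ... | yes _   | no _    | no _    | _       with () ← eq
  ... | no _    | _       | yes _   | no _    with () ← eq
  ... | no _    | _       | no _    | _       with () ← eq

  edge-between : ∀ {u w x y} → adj G x y ≡ true → (x ≡ u × y ≡ w) ⊎ (x ≡ w × y ≡ u) → adj G u w ≡ true
  edge-between xy (inj₁ (refl , refl)) = xy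
  edge-between xy (inj₂ (refl , refl)) = trans (Graph.sym G _ _) xy

  old-edge-not-new : ∀ {u w x y} → adj G u w ≡ false → adj G x y ≡ true → samePair u w x y ≡ false
  old-edge-not-new {u} {w} {x} {y} uw xy with samePair u w x y in eq
  ... | false = refl
  ... | true with () ← trans (sym uw) (edge-between xy (samePair-sound {u} {w} {x} {y} eq))

  keeps-edge : ∀ {u w x y : Fin n} → adj G x y ≡ true → addEdgeAdj G u w x y ≡ true
  keeps-edge xy rewrite xy = refl

  keeps-colour : ∀ {u w x y : Fin n} {k} → adj G u w ≡ false → adj G x y ≡ true → addEdgeCol C u w k x y ≡ col C x y
  keeps-colour uw xy rewrite old-edge-not-new uw xy = refl

  new-edge : ∀ {u w : Fin n} → adj G u w ≡ false → addEdgeAdj G u w u w ≡ true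
  new-edge {u} {w} uw rewrite uw = samePair-refl u w

  new-colour : ∀ {u w : Fin n} {k} → addEdgeCol C u w k u w ≡ k
  new-colour {u} {w} {k} = cong (λ b → if b then k else col C u w) (samePair-refl u w)

  addEdge-rainbowC7 : ∀ (xs : Vec (Fin n) 7) {k} → IsRainbowPath (Vec.toList xs) →
                      adj G (Vec.lookup xs 6F) (Vec.lookup xs 0F) ≡ false → Avoids k (Vec.toList xs) →
                      RainbowC7 (addEdgeAdj G (Vec.lookup xs 6F) (Vec.lookup xs 0F))
                                (addEdgeCol C (Vec.lookup xs 6F) (Vec.lookup xs 0F) k)
  addEdge-rainbowC7 xs@(x₀ ∷ x₁ ∷ x₂ ∷ x₃ ∷ x₄ ∷ x₅ ∷ x₆ ∷ []) {k}
    record { distinct = vertices-distinct ; linked = e₀₁ ∷ e₁₂ ∷ e₂₃ ∷ e₃₄ ∷ e₄₅ ∷ e₅₆ ∷ [-] ; rainbow = ρ }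
    x₆≁x₀ k-fresh =
    Vec.lookup xs , unique-tabulate⁻ vertices-distinct , adjacent , colours-distinct
    where
    adjacent : ∀ i → addEdgeAdj G x₆ x₀ (Vec.lookup xs i) (Vec.lookup xs (next7 i)) ≡ true
    adjacent 0F = keeps-edge e₀₁
    adjacent 1F = keeps-edge e₁₂
    adjacent 2F = keeps-edge e₂₃
    adjacent 3F = keeps-edge e₃₄
    adjacent 4F = keeps-edge e₄₅
    adjacent 5F = keeps-edge e₅₆
    adjacent 6F = new-edge x₆≁x₀

    cycle-colours : Vec ℕ 7
    cycle-colours =
      col C x₀ x₁ ∷ col C x₁ x₂ ∷ col C x₂ x₃ ∷ col C x₃ x₄ ∷ col C x₄ x₅ ∷ col C x₅ x₆ ∷ k ∷ []

    colour-at : ∀ i → addEdgeCol C x₆ x₀ k (Vec.lookup xs i) (Vec.lookup xs (next7 i)) ≡ Vec.lookup cycle-colours i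
    colour-at 0F = keeps-colour x₆≁x₀ e₀₁
    colour-at 1F = keeps-colour x₆≁x₀ e₁₂
    colour-at 2F = keeps-colour x₆≁x₀ e₂₃
    colour-at 3F = keeps-colour x₆≁x₀ e₃₄
    colour-at 4F = keeps-colour x₆≁x₀ e₄₅
    colour-at 5F = keeps-colour x₆≁x₀ e₅₆
    colour-at 6F = new-colour

    colours-distinct : Injective _≡_ _≡_ (λ i → addEdgeCol C x₆ x₀ k (Vec.lookup xs i) (Vec.lookup xs (next7 i)))
    colours-distinct {i} {j} eq = unique-tabulate⁻ (unique-∷ʳ ρ (Allₚ.All¬⇒¬Any k-fresh))
                                          (trans (sym (colour-at i)) (trans eq (colour-at j)))

  close-route : ∀ {cands u w k p} → adj G u w ≡ false → Route cands 5 u w p → Avoids k p →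
                RainbowC7 (addEdgeAdj G u w) (addEdgeCol C u w k)
  close-route {u = u} {w} u≁w (x₁ ∷ x₂ ∷ x₃ ∷ x₄ ∷ x₅ ∷ [] , refl , _ , ρ) =
    addEdge-rainbowC7 (w ∷ x₁ ∷ x₂ ∷ x₃ ∷ x₄ ∷ x₅ ∷ u ∷ []) ρ u≁w

  saturated-by-paths : ∀ cands {u w} → adj G u w ≡ false → AvoidsEach (pathsBetween cands 6 u w) →
                       ∀ k → RainbowC7 (addEdgeAdj G u w) (addEdgeCol C u w k)
  saturated-by-paths cands u≁w paths-ok k =
    let p , p∈ , avoids = find (avoidsEach⇒avoids paths-ok k) in
    close-route u≁w (∈-pathsBetween⁻ cands 5 p∈) avoids

  addEdge-sym : ∀ {u w k} → RainbowC7 (addEdgeAdj G u w) (addEdgeCol C u w k) →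
                RainbowC7 (addEdgeAdj G w u) (addEdgeCol C w u k)
  addEdge-sym {u} {w} {k} (v , v-inj , v-adj , v-rainbow) = v , v-inj , adjacent , colours-distinct
    where
    swap : ∀ x y → samePair w u x y ≡ samePair u w x y
    swap x y = Boolₚ.∨-comm (⌊ x Fin.≟ w ⌋ ∧ ⌊ y Fin.≟ u ⌋) _

    adjacent : ∀ i → addEdgeAdj G w u (v i) (v (next7 i)) ≡ true
    adjacent i = trans (cong (adj G (v i) (v (next7 i)) ∨_) (swap (v i) (v (next7 i)))) (v-adj i)

    recolour : ∀ i → addEdgeCol C w u k (v i) (v (next7 i)) ≡ addEdgeCol C u w k (v i) (v (next7 i))
    recolour i = cong (λ b → if b then k else col C (v i) (v (next7 i))) (swap (v i) (v (next7 i)))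

    colours-distinct : Injective _≡_ _≡_ (λ i → addEdgeCol C w u k (v i) (v (next7 i)))
    colours-distinct {i} {j} eq = v-rainbow (trans (sym (recolour i)) (trans eq (recolour j)))

coreEdges : List (Fin 9 × Fin 9 × ℕ)
coreEdges = (0F , 1F , 0) ∷ (0F , 3F , 2) ∷ (0F , 6F , 0) ∷ (0F , 7F , 14) ∷ (0F , 8F , 1)
          ∷ (1F , 2F , 12) ∷ (1F , 4F , 1) ∷ (1F , 6F , 5) ∷ (2F , 6F , 15) ∷ (2F , 8F , 3)
          ∷ (3F , 7F , 12) ∷ (3F , 8F , 5) ∷ (4F , 5F , 5) ∷ (4F , 7F , 14) ∷ (5F , 8F , 10)
          ∷ (6F , 7F , 4) ∷ []

coreAdj : Fin 9 → Fin 9 → Bool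
coreAdj c d = any (λ (a , b , _) → samePair a b c d) coreEdges

coreColour : Fin 9 → Fin 9 → ℕ
coreColour c d = foldr (λ (a , b , κ) rest → if samePair a b c d then κ else rest) 0 coreEdges

isHub : Fin 9 → Bool
isHub 0F = true
isHub 1F = true
isHub _  = false

coreAdj-sym : ∀ c d → coreAdj c d ≡ coreAdj d c
coreAdj-sym = from-yes (Finₚ.all? λ c → Finₚ.all? λ d → coreAdj c d Bool.≟ coreAdj d c)

coreAdj-irrefl : ∀ c → coreAdj c c ≡ false
coreAdj-irrefl = from-yes (Finₚ.all? λ c → coreAdj c c Bool.≟ false)

coreColour-sym : ∀ c d → coreColour c d ≡ coreColour d c
coreColour-sym = from-yes (Finₚ.all? λ c → Finₚ.all? λ d → coreColour c d ℕ.≟ coreColour d c)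

module Construction (m : ℕ) where

  core : Fin 9 → Fin (10 + m)
  core c = c ↑ˡ suc m

  pendant : Fin (suc m) → Fin (10 + m)
  pendant y = 9 ↑ʳ y

  -- Core colours are below 16, so pendant colours are fresh and pairwise distinct.
  pendantColour : Fin (suc m) → Fin 9 → ℕ
  pendantColour y c = 16 + toℕ (combine y c)

  adjacency : Fin 9 ⊎ Fin (suc m) → Fin 9 ⊎ Fin (suc m) → Bool
  adjacency (inj₁ c) (inj₁ d) = coreAdj c d
  adjacency (inj₁ c) (inj₂ _) = isHub c
  adjacency (inj₂ _) (inj₁ d) = isHub d
  adjacency (inj₂ _) (inj₂ _) = false

  colour : Fin 9 ⊎ Fin (suc m) → Fin 9 ⊎ Fin (suc m) → ℕ
  colour (inj₁ c) (inj₁ d) = coreColour c d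
  colour (inj₁ c) (inj₂ y) = pendantColour y c
  colour (inj₂ y) (inj₁ d) = pendantColour y d
  colour (inj₂ _) (inj₂ _) = 0

  adjacency-sym : ∀ s t → adjacency s t ≡ adjacency t s
  adjacency-sym (inj₁ c) (inj₁ d) = coreAdj-sym c d
  adjacency-sym (inj₁ _) (inj₂ _) = refl
  adjacency-sym (inj₂ _) (inj₁ _) = refl
  adjacency-sym (inj₂ _) (inj₂ _) = refl

  adjacency-irrefl : ∀ s → adjacency s s ≡ false
  adjacency-irrefl (inj₁ c) = coreAdj-irrefl c
  adjacency-irrefl (inj₂ _) = refl

  colour-sym : ∀ s t → colour s t ≡ colour t s
  colour-sym (inj₁ c) (inj₁ d) = coreColour-sym c d
  colour-sym (inj₁ _) (inj₂ _) = refl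
  colour-sym (inj₂ _) (inj₁ _) = refl
  colour-sym (inj₂ _) (inj₂ _) = refl

  graph : Graph (10 + m)
  graph = record
    { adj    = λ i j → adjacency (splitAt 9 i) (splitAt 9 j)
    ; sym    = λ i j → adjacency-sym (splitAt 9 i) (splitAt 9 j)
    ; irrefl = λ i → adjacency-irrefl (splitAt 9 i) }

  colouring : EdgeColoring graph
  colouring = record
    { col    = λ i j → colour (splitAt 9 i) (splitAt 9 j)
    ; colSym = λ i j → colour-sym (splitAt 9 i) (splitAt 9 j) }

  open RainbowPaths Fin._≟_ (adj graph) (col colouring)
  open RainbowCycles (adj graph) (col colouring)
  open AddingEdges graph colouring
  open DecMembership (Fin._≟_ {10 + m}) using (_∈?_)

  data Kind : Fin (10 + m) → Set where
    is-core    : ∀ c → Kind (core c)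
    is-pendant : ∀ y → Kind (pendant y)

  kind : ∀ x → Kind x
  kind x with splitAt 9 x in eq
  ... | inj₁ c = subst Kind (Finₚ.splitAt⁻¹-↑ˡ eq) (is-core c)
  ... | inj₂ y = subst Kind (Finₚ.splitAt⁻¹-↑ʳ eq) (is-pendant y)

  coreVertices : List (Fin (10 + m))
  coreVertices = map core (allFin 9)

  pendantVertices : List (Fin (10 + m))
  pendantVertices = map pendant (allFin (suc m))

  hubs : List (Fin (10 + m))
  hubs = core 0F ∷ core 1F ∷ []

  IsPendant : Fin (10 + m) → Set
  IsPendant x = ∃[ y ] x ≡ pendant y

  core∈coreVertices : ∀ c → core c ∈ coreVertices
  core∈coreVertices c = ∈-map⁺ core (∈-allFin c)

  core≢pendant : ∀ {c y} → core c ≢ pendant y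
  core≢pendant {c} eq with trans (sym (Finₚ.splitAt-↑ˡ 9 c (suc m))) (cong (splitAt 9) eq)
  ... | ()

  pendant∉coreVertices : ∀ {y} → pendant y ∉ coreVertices
  pendant∉coreVertices p∈ with ∈-map⁻ core p∈
  ... | c , _ , eq = core≢pendant (sym eq)

  isPendant? : ∀ x → Dec (IsPendant x)
  isPendant? x with kind x
  ... | is-core c    = no λ (_ , eq) → core≢pendant eq
  ... | is-pendant y = yes (y , refl)

  non-pendant∈coreVertices : ∀ {x} → ¬ IsPendant x → x ∈ coreVertices
  non-pendant∈coreVertices {x} ¬pendant with kind x
  ... | is-core c    = core∈coreVertices c
  ... | is-pendant y = ⊥-elim (¬pendant (y , refl))

  hub-adjacent : ∀ {t} y → t ∈ hubs → adj graph t (pendant y) ≡ true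
  hub-adjacent _ (here refl)         = refl
  hub-adjacent _ (there (here refl)) = refl

  core-hub : ∀ c → isHub c ≡ true → core c ∈ hubs
  core-hub 0F             _  = here refl
  core-hub 1F             _  = there (here refl)
  core-hub (suc (suc _)) ()

  pendant-neighbour : ∀ {x y} → adj graph (pendant y) x ≡ true → x ∈ hubs
  pendant-neighbour {x} x~p with kind x
  ... | is-core c rewrite Finₚ.splitAt-↑ˡ 9 c (suc m) = core-hub c x~p
  ... | is-pendant _ with () ← x~p

  hubs-core : All (_∈ coreVertices) hubs
  hubs-core = core∈coreVertices 0F ∷ core∈coreVertices 1F ∷ []

  hub-not-pendant : ∀ {x} → x ∈ hubs → ¬ IsPendant x
  hub-not-pendant (here refl)         (_ , eq) = core≢pendant eq
  hub-not-pendant (there (here refl)) (_ , eq) = core≢pendant eq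

  no-core-cycle : All (λ s → All (λ p → ¬ ClosesAt s p) (pathsFrom coreVertices 6 [ s ])) coreVertices
  no-core-cycle =
    from-yes (All.all? (λ s → All.all? (λ p → ¬? (closesAt? s p)) (pathsFrom coreVertices 6 [ s ])) coreVertices)

  no-hub-path : All (λ s → All (λ p → ¬ StartsIn hubs p) (pathsFrom coreVertices 5 [ s ])) hubs
  no-hub-path =
    from-yes (All.all? (λ s → All.all? (λ p → ¬? (startsIn? hubs p)) (pathsFrom coreVertices 5 [ s ])) hubs)

  core-cycle-impossible : (R : RainbowC7 (adj graph) (col colouring)) → (∀ i → proj₁ R i ∈ coreVertices) → ⊥
  core-cycle-impossible R v∈ =
    let path , closes = closing-path R in
    All.lookup (All.lookup no-core-cycle (v∈ 0F))
      (pathsFrom-complete coreVertices (tabulate (proj₁ R ∘ suc)) path (Allₚ.tabulate⁺ (v∈ ∘ suc)))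
      closes

  pendant-cycle-impossible : (R : RainbowC7 (adj graph) (col colouring)) → IsPendant (proj₁ R 0F) → ⊥
  pendant-cycle-impossible R@(w , w-inj , w-adj , _) w₀-pendant =
    All.lookup (All.lookup no-hub-path w₆-hub)
      (pathsFrom-complete coreVertices (tabulate (w ∘ suc ∘ inject₁)) (inner-path R)
        (Allₚ.tabulate⁺ λ j → non-pendant∈coreVertices (not-pendant (inject₁ j))))
      w₁-hub
    where
    hub-after : ∀ i → IsPendant (w i) → w (next7 i) ∈ hubs
    hub-after i (_ , eq) = pendant-neighbour (subst (λ x → adj graph x (w (next7 i)) ≡ true) eq (w-adj i))

    hub-before : ∀ i → IsPendant (w (next7 i)) → w i ∈ hubs
    hub-before i (y , eq) =
      pendant-neighbour (trans (Graph.sym graph (pendant y) (w i)) (subst (λ x → adj graph (w i) x ≡ true) eq (w-adj i)))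

    w₁-hub : w 1F ∈ hubs
    w₁-hub = hub-after 0F w₀-pendant

    w₆-hub : w 6F ∈ hubs
    w₆-hub = hub-before 6F w₀-pendant

    -- A pendant vertex at position j + 1 would put hubs at three distinct positions.
    not-pendant : ∀ j → ¬ IsPendant (w (suc j))
    not-pendant 0F p = hub-not-pendant w₁-hub p
    not-pendant 1F p = no-three-into-pair w-inj (λ ()) (λ ()) (λ ()) w₁-hub (hub-after 2F p) w₆-hub
    not-pendant 2F p = no-three-into-pair w-inj (λ ()) (λ ()) (λ ()) w₁-hub (hub-before 2F p) (hub-after 3F p)
    not-pendant 3F p = no-three-into-pair w-inj (λ ()) (λ ()) (λ ()) w₁-hub (hub-before 3F p) (hub-after 4F p)
    not-pendant 4F p = no-three-into-pair w-inj (λ ()) (λ ()) (λ ()) w₁-hub (hub-before 4F p) (hub-after 5F p)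
    not-pendant 5F p = hub-not-pendant w₆-hub p

  no-rainbowC7 : ¬ RainbowC7 (adj graph) (col colouring)
  no-rainbowC7 R with Finₚ.any? (λ i → isPendant? (proj₁ R i))
  ... | yes (i , i-pendant) = let R′ , same = rotate-to i R in
                              pendant-cycle-impossible R′ (subst IsPendant (sym same) i-pendant)
  ... | no  no-pendant      = core-cycle-impossible R λ i → non-pendant∈coreVertices λ p → no-pendant (i , p)

  pendantColour-injective : ∀ y y′ c c′ → pendantColour y c ≡ pendantColour y′ c′ → y ≡ y′ × c ≡ c′
  pendantColour-injective y y′ c c′ eq =
    Finₚ.combine-injective y c y′ c′ (Finₚ.toℕ-injective (ℕₚ.+-cancelˡ-≡ 16 _ _ eq))

  hub-colour-large : ∀ {t} y → t ∈ hubs → 16 ≤ col colouring t (pendant y)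
  hub-colour-large _ (here refl)         = ℕₚ.m≤m+n 16 _
  hub-colour-large _ (there (here refl)) = ℕₚ.m≤m+n 16 _

  hub-colour-injective : ∀ {t t′ y y′} → t ∈ hubs → t′ ∈ hubs →
                         col colouring t (pendant y) ≡ col colouring t′ (pendant y′) → y ≡ y′
  hub-colour-injective {y = y} {y′} (here refl)         (here refl)         eq = proj₁ (pendantColour-injective y y′ 0F 0F eq)
  hub-colour-injective {y = y} {y′} (there (here refl)) (there (here refl)) eq = proj₁ (pendantColour-injective y y′ 1F 1F eq)
  hub-colour-injective {y = y} {y′} (here refl)         (there (here refl)) eq
    with () ← proj₂ (pendantColour-injective y y′ 0F 1F eq)
  hub-colour-injective {y = y} {y′} (there (here refl)) (here refl)         eq
    with () ← proj₂ (pendantColour-injective y y′ 1F 0F eq)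

  core-colours-small : All (λ x → All (λ y → col colouring x y < 16) coreVertices) coreVertices
  core-colours-small =
    from-yes (All.all? (λ x → All.all? (λ y → col colouring x y ℕₚ.<? 16) coreVertices) coreVertices)

  core-path-colours : ∀ {p} → All (_∈ coreVertices) p → All (_< 16) (colours p)
  core-path-colours []              = []
  core-path-colours (_ ∷ [])        = []
  core-path-colours (x∈ ∷ y∈ ∷ p∈) =
    All.lookup (All.lookup core-colours-small x∈) y∈ ∷ core-path-colours (y∈ ∷ p∈)

  route-in-core : ∀ {k s t p} → s ∈ coreVertices → Route coreVertices k s t p → All (_∈ coreVertices) p
  route-in-core s∈ (_ , refl , in-core , _) = Allₚ.++⁺ in-core (s∈ ∷ [])

  route-colours-small : ∀ {k s t p} → s ∈ coreVertices → p ∈ pathsBetween coreVertices (suc k) s t →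
                        All (_< 16) (colours p)
  route-colours-small {k} s∈ p∈ = core-path-colours (route-in-core s∈ (∈-pathsBetween⁻ coreVertices k p∈))

  core-path-avoids : ∀ {k p} → All (_∈ coreVertices) p → 16 ≤ k → Avoids k p
  core-path-avoids p∈ = avoids-above (core-path-colours p∈)

  pendant-free : ∀ {y p} → All (_∈ coreVertices) p → All (pendant y ≢_) p
  pendant-free = All.map λ x∈ eq → pendant∉coreVertices (subst (_∈ coreVertices) (sym eq) x∈)

  close-at-pendant : ∀ {s t p k} y → s ∈ coreVertices → adj graph s (pendant y) ≡ false → t ∈ hubs →
                     Route coreVertices 4 s t p → Avoids k p → k ≢ col colouring (pendant y) t →
                     RainbowC7 (addEdgeAdj graph s (pendant y)) (addEdgeCol colouring s (pendant y) k)
  close-at-pendant {s} {t} y s∈ s≁y t-hub route@(x₂ ∷ x₃ ∷ x₄ ∷ x₅ ∷ [] , refl , _ , ρ) avoids k≢ =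
    addEdge-rainbowC7 (pendant y ∷ t ∷ x₂ ∷ x₃ ∷ x₄ ∷ x₅ ∷ s ∷ [])
      (∷-rainbow (pendant-free in-core , trans (Graph.sym graph (pendant y) t) (hub-adjacent y t-hub) , colour-fresh) ρ)
      s≁y (k≢ ∷ avoids)
    where
    in-core : All (_∈ coreVertices) (t ∷ x₂ ∷ x₃ ∷ x₄ ∷ x₅ ∷ s ∷ [])
    in-core = route-in-core s∈ route

    colour-fresh : Avoids (col colouring (pendant y) t) (t ∷ x₂ ∷ x₃ ∷ x₄ ∷ x₅ ∷ s ∷ [])
    colour-fresh = core-path-avoids in-core
                     (subst (16 ≤_) (EdgeColoring.colSym colouring t (pendant y)) (hub-colour-large y t-hub))

  close-at-pendants : ∀ {t t′ p k} x y → x ≢ y → t ∈ hubs → t′ ∈ hubs →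
                      Route coreVertices 3 t′ t p → Avoids k p →
                      k ∉ col colouring (pendant y) t ∷ [ col colouring t′ (pendant x) ] →
                      RainbowC7 (addEdgeAdj graph (pendant x) (pendant y)) (addEdgeCol colouring (pendant x) (pendant y) k)
  close-at-pendants {t} {t′} x y x≢y t-hub t′-hub route@(x₂ ∷ x₃ ∷ x₄ ∷ [] , refl , _ , ρ) avoids k∉ =
    addEdge-rainbowC7 (pendant y ∷ t ∷ x₂ ∷ x₃ ∷ x₄ ∷ t′ ∷ pendant x ∷ [])
      (∷-rainbow (Allₚ.++⁺ (pendant-free in-core) (y≢x ∷ []) ,
                  trans (Graph.sym graph (pendant y) t) (hub-adjacent y t-hub) ,
                  Allₚ.++⁺ (core-path-avoids in-core y-large) (y-colour≢x-colour ∷ []))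
        (∷ʳ-rainbow (t ∷ x₂ ∷ x₃ ∷ x₄ ∷ []) ρ
           (λ x∈ → pendant∉coreVertices (All.lookup in-core x∈))
           (hub-adjacent x t′-hub)
           (Allₚ.All¬⇒¬Any (core-path-avoids in-core (hub-colour-large x t′-hub)))))
      refl
      (Allₚ.++⁺ ((k∉ ∘ here) ∷ avoids) ((k∉ ∘ there ∘ here) ∷ []))
    where
    in-core : All (_∈ coreVertices) (t ∷ x₂ ∷ x₃ ∷ x₄ ∷ t′ ∷ [])
    in-core = route-in-core (All.lookup hubs-core t′-hub) route

    y≢x : pendant y ≢ pendant x
    y≢x eq = x≢y (sym (Finₚ.↑ʳ-injective 9 y x eq))

    y-large : 16 ≤ col colouring (pendant y) t
    y-large = subst (16 ≤_) (EdgeColoring.colSym colouring t (pendant y)) (hub-colour-large y t-hub)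

    y-colour≢x-colour : col colouring (pendant y) t ≢ col colouring t′ (pendant x)
    y-colour≢x-colour eq =
      x≢y (sym (hub-colour-injective t-hub t′-hub (trans (EdgeColoring.colSym colouring t (pendant y)) eq)))

  -- Some non-edges of H close into a rainbow C₇ only through a pendant vertex.
  core-core-certificate :
    All (λ u → All (λ v → adj graph u v ≡ false → u ≢ v →
                          AvoidsEach (pathsBetween (pendant 0F ∷ coreVertices) 6 u v)) coreVertices) coreVertices
  core-core-certificate = from-yes (All.all? (λ u → All.all? (λ v →
    adj graph u v Bool.≟ false →-dec ¬? (u Fin.≟ v) →-dec avoidsEach? (pathsBetween (pendant 0F ∷ coreVertices) 6 u v))
    coreVertices) coreVertices)

  core-pendant-certificate :
    All (λ s → s ∉ hubs → AvoidsEach (pathsBetween coreVertices 5 s (core 0F) ++ pathsBetween coreVertices 5 s (core 1F))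
                        × Inhabited (pathsBetween coreVertices 5 s (core 0F))
                        × Inhabited (pathsBetween coreVertices 5 s (core 1F))) coreVertices
  core-pendant-certificate = from-yes (All.all? (λ s →
    ¬? (s ∈? hubs) →-dec avoidsEach? (pathsBetween coreVertices 5 s (core 0F) ++ pathsBetween coreVertices 5 s (core 1F))
                   ×-dec inhabited? (pathsBetween coreVertices 5 s (core 0F))
                   ×-dec inhabited? (pathsBetween coreVertices 5 s (core 1F))) coreVertices)

  hub-hub-certificate :
    AvoidsEach (pathsBetween coreVertices 4 (core 1F) (core 0F) ++ pathsBetween coreVertices 4 (core 0F) (core 1F))
    × Inhabited (pathsBetween coreVertices 4 (core 1F) (core 0F))
    × Inhabited (pathsBetween coreVertices 4 (core 0F) (core 1F))
  hub-hub-certificate = from-yes (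
    avoidsEach? (pathsBetween coreVertices 4 (core 1F) (core 0F) ++ pathsBetween coreVertices 4 (core 0F) (core 1F))
    ×-dec inhabited? (pathsBetween coreVertices 4 (core 1F) (core 0F))
    ×-dec inhabited? (pathsBetween coreVertices 4 (core 0F) (core 1F)))

  core-pendant-saturated : ∀ {s} y → s ∈ coreVertices → adj graph s (pendant y) ≡ false →
                           ∀ k → RainbowC7 (addEdgeAdj graph s (pendant y)) (addEdgeCol colouring s (pendant y) k)
  core-pendant-saturated {s} y s∈ s≁y k =
    let paths-ok , inhabited₀ , inhabited₁ = All.lookup core-pendant-certificate s∈ s∉hubs in
    [ close (here refl) , close (there (here refl)) ]′
      (avoid-one-side {E₀ = [ pendantColour y 0F ]} {E₁ = [ pendantColour y 1F ]}
                      paths-ok inhabited₀ inhabited₁ small (ℕₚ.m≤m+n 16 _ ∷ ℕₚ.m≤m+n 16 _ ∷ []) disjoint k)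
    where
    close : ∀ {t} → t ∈ hubs →
            ∃[ p ] p ∈ pathsBetween coreVertices 5 s t × Avoids k p × k ∉ [ col colouring (pendant y) t ] →
            RainbowC7 (addEdgeAdj graph s (pendant y)) (addEdgeCol colouring s (pendant y) k)
    close t-hub (_ , p∈ , avoids , k∉) =
      close-at-pendant y s∈ s≁y t-hub (∈-pathsBetween⁻ coreVertices 4 p∈) avoids (k∉ ∘ here)

    s∉hubs : s ∉ hubs
    s∉hubs s-hub with () ← trans (sym (hub-adjacent y s-hub)) s≁y

    small : ∀ {p} → p ∈ pathsBetween coreVertices 5 s (core 0F) ++ pathsBetween coreVertices 5 s (core 1F) →
            All (_< 16) (colours p)
    small p∈ = [ route-colours-small {k = 4} {t = core 0F} s∈ , route-colours-small {k = 4} {t = core 1F} s∈ ]′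
                 (∈-++⁻ (pathsBetween coreVertices 5 s (core 0F)) p∈)

    disjoint : ∀ {κ} → κ ∈ [ pendantColour y 0F ] → κ ∉ [ pendantColour y 1F ]
    disjoint (here refl) (here eq) with () ← proj₂ (pendantColour-injective y y 0F 1F eq)

  pendants-saturated : ∀ x y → x ≢ y →
                       ∀ k → RainbowC7 (addEdgeAdj graph (pendant x) (pendant y))
                                       (addEdgeCol colouring (pendant x) (pendant y) k)
  pendants-saturated x y x≢y k =
    let paths-ok , inhabited₀ , inhabited₁ = hub-hub-certificate in
    [ close (here refl) (there (here refl)) , close (there (here refl)) (here refl) ]′
      (avoid-one-side {E₀ = ends₀} {E₁ = ends₁} paths-ok inhabited₀ inhabited₁ small large disjoint k)
    where
    ends₀ ends₁ : List ℕ
    ends₀ = pendantColour y 0F ∷ [ pendantColour x 1F ]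
    ends₁ = pendantColour y 1F ∷ [ pendantColour x 0F ]

    large : All (16 ≤_) (ends₀ ++ ends₁)
    large = ℕₚ.m≤m+n 16 _ ∷ ℕₚ.m≤m+n 16 _ ∷ ℕₚ.m≤m+n 16 _ ∷ ℕₚ.m≤m+n 16 _ ∷ []

    close : ∀ {t t′} → t ∈ hubs → t′ ∈ hubs →
            ∃[ p ] p ∈ pathsBetween coreVertices 4 t′ t × Avoids k p
                   × k ∉ col colouring (pendant y) t ∷ [ col colouring t′ (pendant x) ] →
            RainbowC7 (addEdgeAdj graph (pendant x) (pendant y)) (addEdgeCol colouring (pendant x) (pendant y) k)
    close t-hub t′-hub (_ , p∈ , avoids , k∉) =
      close-at-pendants x y x≢y t-hub t′-hub (∈-pathsBetween⁻ coreVertices 3 p∈) avoids k∉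

    small : ∀ {p} → p ∈ pathsBetween coreVertices 4 (core 1F) (core 0F) ++
                        pathsBetween coreVertices 4 (core 0F) (core 1F) → All (_< 16) (colours p)
    small p∈ = [ route-colours-small {k = 3} {t = core 0F} (core∈coreVertices 1F)
               , route-colours-small {k = 3} {t = core 1F} (core∈coreVertices 0F)
               ]′ (∈-++⁻ (pathsBetween coreVertices 4 (core 1F) (core 0F)) p∈)

    disjoint : ∀ {κ} → κ ∈ ends₀ → κ ∉ ends₁
    disjoint (here refl)         (here eq)         with () ← proj₂ (pendantColour-injective y y 0F 1F eq)
    disjoint (here refl)         (there (here eq)) = x≢y (sym (proj₁ (pendantColour-injective y x 0F 0F eq)))
    disjoint (there (here refl)) (here eq)         = x≢y (proj₁ (pendantColour-injective x y 1F 1F eq))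
    disjoint (there (here refl)) (there (here eq)) with () ← proj₂ (pendantColour-injective x x 1F 0F eq)

  saturated : ∀ u v → u ≢ v → adj graph u v ≡ false →
              ∀ k → RainbowC7 (addEdgeAdj graph u v) (addEdgeCol colouring u v k)
  saturated u v u≢v u≁v k with kind u | kind v
  ... | is-core c    | is-core d    =
    saturated-by-paths (pendant 0F ∷ coreVertices) u≁v
      (All.lookup (All.lookup core-core-certificate (core∈coreVertices c)) (core∈coreVertices d) u≁v u≢v) k
  ... | is-core c    | is-pendant y = core-pendant-saturated y (core∈coreVertices c) u≁v k
  ... | is-pendant y | is-core c    =
    addEdge-sym (core-pendant-saturated y (core∈coreVertices c) (trans (Graph.sym graph (core c) (pendant y)) u≁v) k)
  ... | is-pendant x | is-pendant y = pendants-saturated x y (u≢v ∘ cong pendant) k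

  precedes : Fin (10 + m) → Fin (10 + m) → Bool
  precedes i j = ⌊ toℕ i ℕₚ.<? toℕ j ⌋

  above : Fin (10 + m) → Fin (10 + m) → ℕ
  above i j = if precedes i j ∧ adj graph i j then 1 else 0

  upperDegree : Fin (10 + m) → ℕ
  upperDegree i = sum (map (above i) (allFin (10 + m)))

  coresAbove : Fin (10 + m) → ℕ
  coresAbove i = sum (map (above i) coreVertices)

  pendantsAbove : Fin (10 + m) → ℕ
  pendantsAbove i = sum (map (above i ∘ pendant) (allFin (suc m)))

  allFin-split : allFin (10 + m) ≡ coreVertices ++ pendantVertices
  allFin-split = cong (coreVertices ++_) (sym (Listₚ.map-tabulate id pendant))

  sum-over-vertices : ∀ f → sum (map f (allFin (10 + m))) ≡
                            sum (map f coreVertices) + sum (map (f ∘ pendant) (allFin (suc m)))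
  sum-over-vertices f = begin
    sum (map f (allFin (10 + m)))                          ≡⟨ cong (sum ∘ map f) allFin-split ⟩
    sum (map f (coreVertices ++ pendantVertices))          ≡⟨ cong sum (Listₚ.map-++ f coreVertices pendantVertices) ⟩
    sum (map f coreVertices ++ map f pendantVertices)      ≡⟨ Sumₚ.sum-++ (map f coreVertices) (map f pendantVertices) ⟩
    sum (map f coreVertices) + sum (map f pendantVertices)
      ≡⟨ cong (λ xs → sum (map f coreVertices) + sum xs) (Listₚ.map-∘ {g = f} {f = pendant} (allFin (suc m))) ⟨
    sum (map f coreVertices) + sum (map (f ∘ pendant) (allFin (suc m))) ∎
    where open ≡-Reasoning

  above-core-pendant : ∀ y c → above (core c) (pendant y) ≡ (if isHub c then 1 else 0)
  above-core-pendant y = from-yes (Finₚ.all? λ c → above (core c) (pendant y) ℕ.≟ (if isHub c then 1 else 0))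

  pendantsAbove-core : ∀ c → pendantsAbove (core c) ≡ (if isHub c then suc m else 0)
  pendantsAbove-core c = begin
    pendantsAbove (core c)
      ≡⟨ cong sum (Listₚ.map-cong (λ y → above-core-pendant y c) (allFin (suc m))) ⟩
    sum (map (λ _ → if isHub c then 1 else 0) (allFin (suc m)))
      ≡⟨ sum-map-if (isHub c) (allFin (suc m)) ⟩
    (if isHub c then length (allFin (suc m)) else 0)
      ≡⟨ cong (λ l → if isHub c then l else 0) (Listₚ.length-tabulate id) ⟩
    (if isHub c then suc m else 0) ∎
    where open ≡-Reasoning

  upperDegree-pendant : ∀ y → upperDegree (pendant y) ≡ 0
  upperDegree-pendant y = begin
    upperDegree (pendant y)                ≡⟨ sum-over-vertices (above (pendant y)) ⟩
    pendantsAbove (pendant y)              ≡⟨ cong sum (Listₚ.map-cong no-pendant-above (allFin (suc m))) ⟩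
    sum (map (λ _ → 0) (allFin (suc m)))   ≡⟨ sum-map-if false (allFin (suc m)) ⟩
    0                                      ∎
    where
    open ≡-Reasoning
    no-pendant-above : ∀ y′ → above (pendant y) (pendant y′) ≡ 0
    no-pendant-above y′ = cong (λ b → if b then 1 else 0) (Boolₚ.∧-zeroʳ (precedes (pendant y) (pendant y′)))

  core-rows : sum (map upperDegree coreVertices) ≡ 16 + 2 * suc m
  core-rows = begin
    sum (map upperDegree coreVertices)
      ≡⟨ cong sum (Listₚ.map-cong (λ i → sum-over-vertices (above i)) coreVertices) ⟩
    sum (map (λ i → coresAbove i + pendantsAbove i) coreVertices)
      ≡⟨ sum-map-+ coresAbove pendantsAbove coreVertices ⟩
    16 + sum (map (pendantsAbove ∘ core) (allFin 9))
      ≡⟨ cong (λ xs → 16 + sum xs) (Listₚ.map-cong pendantsAbove-core (allFin 9)) ⟩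
    16 + 2 * suc m ∎
    where open ≡-Reasoning

  edgeCount-graph : edgeCount graph ≡ 2 * (9 + m)
  edgeCount-graph = begin
    edgeCount graph
      ≡⟨ sum-over-vertices upperDegree ⟩
    sum (map upperDegree coreVertices) + sum (map (upperDegree ∘ pendant) (allFin (suc m)))
      ≡⟨ cong₂ _+_ core-rows (cong sum (Listₚ.map-cong upperDegree-pendant (allFin (suc m)))) ⟩
    16 + 2 * suc m + sum (map (λ _ → 0) (allFin (suc m)))
      ≡⟨ cong (16 + 2 * suc m +_) (sum-map-if false (allFin (suc m))) ⟩
    16 + 2 * suc m + 0
      ≡⟨ ℕₚ.+-identityʳ _ ⟩
    16 + 2 * suc m
      ≡⟨ ℕₚ.*-distribˡ-+ 2 8 (suc m) ⟨
    2 * (9 + m) ∎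
    where open ≡-Reasoning

theorem1p5 : (n : ℕ) → 10 ≤ n → RsatC7≤ n (2 * n ∸ 2)
theorem1p5 n 10≤n with ℕₚ.m≤n⇒∃[o]m+o≡n 10≤n
... | m , refl = graph , edges , colouring , no-rainbowC7 , saturated
  where
  open Construction m
  edges : edgeCount graph ≤ 2 * (10 + m) ∸ 2
  edges = ℕₚ.≤-reflexive (trans edgeCount-graph (ℕₚ.*-distribˡ-∸ 2 (10 + m) 1))
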